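{- Let $k$ and $t$ be positive integers, let $I_k=[-k,k]=\{i\in\mathbb{Z}: -k\le i\le k\}$, and let $D(I_k)=\max\{2,2k-1\}$. (i) If $\mathsf{s}'_t(I_k)$ is finite, then every integer in $[1,D(I_k)]$ divides $t$. (ii) If every integer in $[1,D(I_k)]$ divides $t$, then \[t+k(k-1)\le \mathsf{s}'_t(I_k)\le t+(2k-2)(2k-3).\]
   Context: A sequence over a set $G_0\subseteq\mathbb{Z}$ is a finite unordered list of elements of $G_0$ with repetition allowed (a finite multiset). Its length $|S|$ is the number of terms counted with multiplicity, and its sum $\sigma(S)$ is the sum of its terms. A subsequence is a sub-multiset. $S$ is zero-sum if $\sigma(S)=0$. A zero-sum sequence is minimal if it is nonempty and contains no proper nonempty zero-sum subsequence. The Davenport constant $D(I_k)$ is the maximum length of a minimal zero-sum sequence over $I_k$; it is known (Lambert) that $D(I_k)=\max\{2,2k-1\}$. For a positive integer $t$, $\mathsf{s}'_t(I_k)$ is the smallest positive integer $\ell$ such that every zero-sum sequence $S$ over $I_k$ with $|S|\ge\ell$ contains a zero-sum subsequence of length $t$; if no such $\ell$ exists, $\mathsf{s}'_t(I_k)=\infty$. -}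

module Defs where

open import Data.Nat as ℕ using (ℕ; _⊔_; _∸_; _≤_)
open import Data.Integer as ℤ using (ℤ; +_; -_)
open import Data.List using (List; length; foldr)
open import Data.List.Relation.Unary.All using (All)
open import Data.List.Relation.Binary.Sublist.Propositional using (_⊆_)
open import Data.Product using (Σ; _×_)
open import Relation.Binary.PropositionalEquality using (_≡_)

InI : ℕ → ℤ → Set
InI k x = (- (+ k)) ℤ.≤ x × x ℤ.≤ + k

-- a sequence over I_k (a finite multiset, represented by a list)
SeqOver : ℕ → List ℤ → Set
SeqOver k S = All (InI k) S

σ : List ℤ → ℤ
σ = foldr ℤ._+_ (+ 0)

ZeroSum : List ℤ → Set
ZeroSum S = σ S ≡ + 0

-- Sub-multisets of a multiset represented by a list S are exactly (up to
-- reordering) the sublists T ⊆ S.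
-- ℓ has the defining property of s'_t(I_k): every zero-sum sequence S over I_k
-- with |S| ≥ ℓ has a zero-sum subsequence of length t.
Good : ℕ → ℕ → ℕ → Set
Good k t ℓ = (S : List ℤ) → SeqOver k S → ZeroSum S → ℓ ≤ length S →
             Σ (List ℤ) λ T → T ⊆ S × ZeroSum T × length T ≡ t

S'Finite : ℕ → ℕ → Set
S'Finite k t = Σ ℕ λ ℓ → 1 ≤ ℓ × Good k t ℓ

D : ℕ → ℕ
D k = 2 ⊔ (2 ℕ.* k ∸ 1)

-- (i) For 0 ≤ c ≤ k and 1 ≤ e ≤ k the zero-sum sequence c^{ℓe} (−e)^{ℓc} is as long as we like,
-- and a zero-sum subsequence of length t of it forces c + e ∣ ct.  Every d ∈ [3, 2k − 1] is the
-- sum of both pairs (c, e + 1) and (c + 1, e) for admissible c, e, so d divides ct and (c + 1)t,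
-- hence t.
-- (ii) Lower bound: if t − 1 = r + qk with r < k, the sequence k^r (k − 1)^{q+k−1−r} (−1)^{…} has
-- length t − 1 + k(k − 1) but no zero-sum subsequence of length t.
-- Upper bound: a zero-sum sequence over I_k splits into zero-sum blocks of length at most
-- D = D(I_k), because the terms can be ordered so that the partial sums stay in [1 − k, k − 1].
-- If 1, …, D all divide t, a multiset of numbers in [1, D] with total at least t + (D − 1)(D − 2)
-- has a sub-multiset summing to t; the corresponding blocks form the required subsequence.

module Submission where

open import Defs
open import Data.Nat using (ℕ; _≤_; _+_; _*_; _∸_; _<_)
open import Data.Nat.Divisibility using (_∣_)
open import Data.Product using (_×_)

open import Data.Nat using (zero; suc; pred; z≤n; s≤s; _≟_; _≤?_; _<?_; _⊔_; NonZero; >-nonZero⁻¹)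
open import Data.Nat.Properties
open import Data.Nat.Divisibility using (divides; ∣m+n∣m⇒∣n; ∣m∣n⇒∣m+n; ∣⇒≤; m∣m*n; n∣m*n; 1∣_; ∣1⇒≡1)
open import Data.Nat.DivMod using (_%_; _/_; m≡m%n+[m/n]*n; m%n<n)
open import Data.Nat.Coprimality using (Coprime; coprime-divisor)
open import Data.Nat.ListAction using (sum)
open import Data.Nat.ListAction.Properties using (sum-++; sum-↭)
open import Data.Nat.Tactic.RingSolver using (solve-∀)
open import Data.Integer as ℤ using (ℤ; +_; -_; -[1+_]; 0ℤ; -1ℤ)
  renaming (_+_ to _+ℤ_; _*_ to _*ℤ_; _<_ to _<ℤ_)
import Data.Integer.Properties as ℤ
import Data.Integer.Tactic.RingSolver as ℤ-Ring
open import Data.Fin using (toℕ; fromℕ<)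
import Data.Fin.Properties as Fin
open import Data.List using (List; []; _∷_; _++_; length; replicate; take; drop; concat; map)
open import Data.List.Properties
  using (drop-[]; length-take; length-++; length-replicate; take++drop≡id; ++-assoc; concat-++; map-++)
open import Data.List.Relation.Unary.All as All using (All; []; _∷_)
open import Data.List.Relation.Unary.All.Properties using (++⁺; ++⁻; replicate⁺; take⁺; ¬Any⇒All¬; partition-All)
open import Data.List.Relation.Unary.Any using (Any; here; there; any?)
open import Data.List.Relation.Binary.Sublist.Propositional using (_⊆_; []; _∷_; _∷ʳ_; ⊆-refl)
open import Data.List.Relation.Binary.Sublist.Propositional.Properties as Sublist using (All-resp-⊆)
open import Data.List.Relation.Binary.Permutation.Propositional
  using (_↭_; prep; swap; ↭-refl; ↭-sym; ↭-trans; ↭-reflexive; ↭⇒↭ₛ; ↭ₛ⇒↭; module PermutationReasoning)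
open import Data.List.Relation.Binary.Permutation.Propositional.Properties
  using (All-resp-↭; shift; shifts; ++⁺ˡ; ++⁺ʳ; ++-comm; ↭-length)
import Data.List.Relation.Binary.Permutation.Propositional.Properties as ↭
import Data.List.Relation.Binary.Permutation.Setoid.Properties as Setoid↭
open import Data.Product using (∃₂; ∃-syntax; _,_; proj₁; proj₂)
open import Data.Sum using (_⊎_; inj₁; inj₂)
open import Data.Empty using (⊥; ⊥-elim)
open import Function using (_∘_)
open import Relation.Binary.PropositionalEquality
open import Relation.Nullary using (¬_; Dec; yes; no; _×-dec_)
open import Relation.Binary.Definitions using (Tri; tri<; tri≈; tri>)

private variable
  A : Set

σ-++ : ∀ (xs ys : List ℤ) → σ (xs ++ ys) ≡ σ xs +ℤ σ ys
σ-++ []       ys = sym (ℤ.+-identityˡ (σ ys))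
σ-++ (x ∷ xs) ys = trans (cong (x +ℤ_) (σ-++ xs ys)) (sym (ℤ.+-assoc x (σ xs) (σ ys)))

σ-↭ : {xs ys : List ℤ} → xs ↭ ys → σ xs ≡ σ ys
σ-↭ p = Setoid↭.foldr-commMonoid (setoid ℤ) ℤ.+-0-isCommutativeMonoid (↭⇒↭ₛ p)

σ-replicate : ∀ n x → σ (replicate n x) ≡ + n *ℤ x
σ-replicate zero    x = sym (ℤ.*-zeroˡ x)
σ-replicate (suc n) x = begin
  x +ℤ σ (replicate n x) ≡⟨ cong (x +ℤ_) (σ-replicate n x) ⟩
  x +ℤ + n *ℤ x         ≡⟨ ℤ.suc-* (+ n) x ⟨
  + suc n *ℤ x           ∎
  where open ≡-Reasoning

+ℤ-cancelʳ : ∀ a b c → a +ℤ c ≡ b +ℤ c → a ≡ b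
+ℤ-cancelʳ a b c eq = trans (regroup a c) (trans (cong (_+ℤ - c) eq) (sym (regroup b c)))
  where
  regroup : ∀ a c → a ≡ (a +ℤ c) +ℤ - c
  regroup = ℤ-Ring.solve-∀

σ-complement : ∀ P {R S} → P ++ R ↭ S → ZeroSum S → σ R ≡ - σ P
σ-complement P {R} P++R↭S S-zero = begin
  σ R                      ≡⟨ regroup (σ P) (σ R) ⟩
  (σ P +ℤ σ R) +ℤ - σ P    ≡⟨ cong (_+ℤ - σ P) (trans (sym (σ-++ P R)) (trans (σ-↭ P++R↭S) S-zero)) ⟩
  0ℤ +ℤ - σ P              ≡⟨ ℤ.+-identityˡ (- σ P) ⟩
  - σ P                    ∎
  where
  open ≡-Reasoning
  regroup : ∀ a b → b ≡ (a +ℤ b) +ℤ - a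
  regroup = ℤ-Ring.solve-∀

σ-++≡σʳ⇒ZeroSum : ∀ xs ys → σ (xs ++ ys) ≡ σ ys → ZeroSum xs
σ-++≡σʳ⇒ZeroSum xs ys eq =
  +ℤ-cancelʳ (σ xs) 0ℤ (σ ys) (trans (sym (σ-++ xs ys)) (trans eq (sym (ℤ.+-identityˡ (σ ys)))))

σ-tail : ∀ x S → ZeroSum (x ∷ S) → σ S ≡ - x
σ-tail x S x∷S-zero = trans (σ-complement (x ∷ []) {S} ↭-refl x∷S-zero) (cong -_ (ℤ.+-identityʳ x))

σ-three-valued : ∀ {a b c} (L : List ℤ) → All (λ x → x ≡ a ⊎ x ≡ b ⊎ x ≡ c) L →
  ∃[ p ] ∃[ q ] ∃[ r ] (p + q + r ≡ length L) × (σ L ≡ + p *ℤ a +ℤ + q *ℤ b +ℤ + r *ℤ c)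
σ-three-valued [] [] = 0 , 0 , 0 , refl , refl
σ-three-valued {a} {b} {c} (x ∷ L) (x≡ ∷ L-values) with σ-three-valued L L-values
... | p , q , r , len , σL≡ with x≡
...   | inj₁ refl = suc p , q , r , cong suc len ,
          trans (cong (a +ℤ_) σL≡) (count-a a b c (+ p) (+ q) (+ r))
  where
  count-a : ∀ a b c p q r → a +ℤ (p *ℤ a +ℤ q *ℤ b +ℤ r *ℤ c) ≡ (+ 1 +ℤ p) *ℤ a +ℤ q *ℤ b +ℤ r *ℤ c
  count-a = ℤ-Ring.solve-∀
...   | inj₂ (inj₁ refl) = p , suc q , r , trans (cong (_+ r) (+-suc p q)) (cong suc len) ,
          trans (cong (b +ℤ_) σL≡) (count-b a b c (+ p) (+ q) (+ r))
  where
  count-b : ∀ a b c p q r → b +ℤ (p *ℤ a +ℤ q *ℤ b +ℤ r *ℤ c) ≡ p *ℤ a +ℤ (+ 1 +ℤ q) *ℤ b +ℤ r *ℤ c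
  count-b = ℤ-Ring.solve-∀
...   | inj₂ (inj₂ refl) = p , q , suc r , trans (+-suc (p + q) r) (cong suc len) ,
          trans (cong (c +ℤ_) σL≡) (count-c a b c (+ p) (+ q) (+ r))
  where
  count-c : ∀ a b c p q r → c +ℤ (p *ℤ a +ℤ q *ℤ b +ℤ r *ℤ c) ≡ p *ℤ a +ℤ q *ℤ b +ℤ (+ 1 +ℤ r) *ℤ c
  count-c = ℤ-Ring.solve-∀

Any-extract : {P : A → Set} {xs : List A} → Any P xs → ∃[ x ] ∃[ ys ] P x × (x ∷ ys ↭ xs)
Any-extract {xs = x ∷ xs} (here px) = x , xs , px , ↭-refl
Any-extract {xs = x ∷ xs} (there any) with Any-extract any
... | y , ys , py , y∷ys↭xs = y , x ∷ ys , py , ↭-trans (swap y x ↭-refl) (prep x y∷ys↭xs)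

⊆⇒++-↭ : {T S : List A} → T ⊆ S → ∃[ C ] T ++ C ↭ S
⊆⇒++-↭ []         = [] , ↭-refl
⊆⇒++-↭ (y ∷ʳ T⊆S) with ⊆⇒++-↭ T⊆S
... | C , T++C↭S = y ∷ C , ↭-trans (shift y _ C) (prep y T++C↭S)
⊆⇒++-↭ (refl ∷ T⊆S) with ⊆⇒++-↭ T⊆S
... | C , T++C↭S = C , prep _ T++C↭S

⊆-resp-↭ : {T xs ys : List A} → xs ↭ ys → T ⊆ xs → ∃[ T′ ] T′ ↭ T × T′ ⊆ ys
⊆-resp-↭ _↭_.refl T⊆ = _ , ↭-refl , T⊆
⊆-resp-↭ (prep x p) (.x ∷ʳ T⊆) with ⊆-resp-↭ p T⊆
... | T′ , e , T′⊆ = T′ , e , x ∷ʳ T′⊆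
⊆-resp-↭ (prep x p) (refl ∷ T⊆) with ⊆-resp-↭ p T⊆
... | T′ , e , T′⊆ = x ∷ T′ , prep x e , refl ∷ T′⊆
⊆-resp-↭ (swap x y p) (.x ∷ʳ (.y ∷ʳ T⊆)) with ⊆-resp-↭ p T⊆
... | T′ , e , T′⊆ = T′ , e , y ∷ʳ (x ∷ʳ T′⊆)
⊆-resp-↭ (swap x y p) (.x ∷ʳ (refl ∷ T⊆)) with ⊆-resp-↭ p T⊆
... | T′ , e , T′⊆ = y ∷ T′ , prep y e , refl ∷ (x ∷ʳ T′⊆)
⊆-resp-↭ (swap x y p) (refl ∷ (.y ∷ʳ T⊆)) with ⊆-resp-↭ p T⊆
... | T′ , e , T′⊆ = x ∷ T′ , prep x e , y ∷ʳ (refl ∷ T′⊆)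
⊆-resp-↭ (swap x y p) (refl ∷ (refl ∷ T⊆)) with ⊆-resp-↭ p T⊆
... | T′ , e , T′⊆ = y ∷ x ∷ T′ , swap y x e , refl ∷ (refl ∷ T′⊆)
⊆-resp-↭ (_↭_.trans p q) T⊆ with ⊆-resp-↭ p T⊆
... | T₁ , e₁ , T₁⊆ with ⊆-resp-↭ q T₁⊆
... | T₂ , e₂ , T₂⊆ = T₂ , ↭-trans e₂ e₁ , T₂⊆

partition-↭ : {P : A → Set} (P? : ∀ x → Dec (P x)) (xs : List A) →
  ∃₂ λ ys zs → ys ++ zs ↭ xs × All P ys × All (¬_ ∘ P) zs
partition-↭ P? xs =
  _ , _ , ↭-sym (↭ₛ⇒↭ (Setoid↭.partition-↭ (setoid _) P? xs)) , partition-All P? xs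

pigeonhole-ℕ : ∀ n (g : ℕ → ℕ) → (∀ i → i ≤ n → g i < n) → ∃[ i ] ∃[ j ] i < j × j ≤ n × g i ≡ g j
pigeonhole-ℕ n g g<n with Fin.pigeonhole (n<1+n n) (λ i → fromℕ< (g<n (toℕ i) (Fin.toℕ≤pred[n] i)))
... | i , j , i<j , gi≡gj = toℕ i , toℕ j , i<j , Fin.toℕ≤pred[n] j , (begin
  g (toℕ i)                                         ≡⟨ Fin.toℕ-fromℕ< _ ⟨
  toℕ (fromℕ< (g<n (toℕ i) (Fin.toℕ≤pred[n] i)))    ≡⟨ cong toℕ gi≡gj ⟩
  toℕ (fromℕ< (g<n (toℕ j) (Fin.toℕ≤pred[n] j)))    ≡⟨ Fin.toℕ-fromℕ< _ ⟩
  g (toℕ j)                                         ∎)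
  where open ≡-Reasoning

drop-split : ∀ {i j} (P : List A) → i ≤ j → j ≤ length P →
  ∃[ sg ] drop i P ≡ sg ++ drop j P × length sg ≡ j ∸ i
drop-split {i = zero}  {zero}  P       _         _         = [] , refl , refl
drop-split {i = zero}  {suc j} (x ∷ P) _         (s≤s j≤) with drop-split P z≤n j≤
... | sg , P≡ , len = x ∷ sg , cong (x ∷_) P≡ , cong suc len
drop-split {i = suc i} {suc j} (x ∷ P) (s≤s i≤j) (s≤s j≤) = drop-split P i≤j j≤

infix-pigeonhole : ∀ n (f : List A → ℕ) (P : List A) → n ≤ length P → (∀ i → i ≤ n → f (drop i P) < n) →
  ∃[ i ] ∃[ j ] ∃[ sg ] ∃[ rest ] drop i P ≡ sg ++ drop j P × sg ++ rest ↭ P ×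
    1 ≤ length sg × length sg ≤ n × f (drop i P) ≡ f (drop j P)
infix-pigeonhole n f P n≤len f<n with pigeonhole-ℕ n (λ i → f (drop i P)) f<n
... | i , j , i<j , j≤n , fi≡fj with drop-split P (<⇒≤ i<j) (≤-trans j≤n n≤len)
... | sg , dropᵢ≡ , len =
  i , j , sg , take i P ++ drop j P , dropᵢ≡ , sg++rest↭P ,
  subst (1 ≤_) (sym len) (m<n⇒0<n∸m i<j) , subst (_≤ n) (sym len) (≤-trans (m∸n≤m j i) j≤n) , fi≡fj
  where
  sg++rest↭P : sg ++ take i P ++ drop j P ↭ P
  sg++rest↭P = ↭-trans (shifts sg (take i P))
    (↭-reflexive (trans (cong (take i P ++_) (sym dropᵢ≡)) (take++drop≡id i P)))

-- Divisibility of t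

InI-+ : ∀ {k c} → c ≤ k → InI k (+ c)
InI-+ c≤k = ℤ.≤-trans ℤ.neg-≤-pos (ℤ.+≤+ z≤n) , ℤ.+≤+ c≤k

InI-- : ∀ {k e} → e ≤ k → InI k (- + e)
InI-- e≤k = ℤ.neg-mono-≤ (ℤ.+≤+ e≤k) , ℤ.neg-≤-pos

balanced : ℕ → ℕ → ℕ → List ℤ
balanced ℓ c e = replicate (ℓ * e) (+ c) ++ replicate (ℓ * c) (- + e)

balanced-zero-sum : ∀ ℓ c e → ZeroSum (balanced ℓ c e)
balanced-zero-sum ℓ c e = begin
  σ (balanced ℓ c e)                                    ≡⟨ σ-++ (replicate (ℓ * e) (+ c)) _ ⟩
  σ (replicate (ℓ * e) (+ c)) +ℤ σ (replicate (ℓ * c) (- + e))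
    ≡⟨ cong₂ _+ℤ_ (σ-replicate (ℓ * e) (+ c)) (σ-replicate (ℓ * c) (- + e)) ⟩
  + (ℓ * e) *ℤ + c +ℤ + (ℓ * c) *ℤ - + e
    ≡⟨ cong₂ (λ x y → x *ℤ + c +ℤ y *ℤ - + e) (ℤ.pos-* ℓ e) (ℤ.pos-* ℓ c) ⟩
  + ℓ *ℤ + e *ℤ + c +ℤ + ℓ *ℤ + c *ℤ - + e              ≡⟨ cancel (+ ℓ) (+ c) (+ e) ⟩
  0ℤ                                                    ∎
  where
  open ≡-Reasoning
  cancel : ∀ l c e → l *ℤ e *ℤ c +ℤ l *ℤ c *ℤ - e ≡ 0ℤ
  cancel = ℤ-Ring.solve-∀

balance : ∀ p q r c e → + p *ℤ + c +ℤ + q *ℤ - + e +ℤ + r *ℤ - + e ≡ 0ℤ → p * c ≡ (q + r) * e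
balance p q r c e sum≡0 = ℤ.+-injective (begin
  + (p * c)                                                      ≡⟨ ℤ.pos-* p c ⟩
  + p *ℤ + c                                                     ≡⟨ shuffle (+ p) (+ q) (+ r) (+ c) (+ e) ⟩
  (+ p *ℤ + c +ℤ + q *ℤ - + e +ℤ + r *ℤ - + e) +ℤ (+ q +ℤ + r) *ℤ + e
                                                                 ≡⟨ cong (_+ℤ (+ q +ℤ + r) *ℤ + e) sum≡0 ⟩
  0ℤ +ℤ + (q + r) *ℤ + e                                         ≡⟨ ℤ.+-identityˡ _ ⟩
  + (q + r) *ℤ + e                                               ≡⟨ ℤ.pos-* (q + r) e ⟨
  + ((q + r) * e)                                                ∎)
  where
  open ≡-Reasoning
  shuffle : ∀ p q r c e → p *ℤ c ≡ (p *ℤ c +ℤ q *ℤ - e +ℤ r *ℤ - e) +ℤ (q +ℤ r) *ℤ e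
  shuffle = ℤ-Ring.solve-∀

-- A zero-sum subsequence of length t of c^{ℓe} (−e)^{ℓc} has p terms c and q terms −e with
-- pc = qe and p + q = t, whence ct = q(c + e).
Good⇒+∣*t : ∀ {k t ℓ c e} → Good k t ℓ → c ≤ k → 1 ≤ e → e ≤ k → c + e ∣ c * t
Good⇒+∣*t {k} {t} {ℓ} {c} {e} good c≤k 1≤e e≤k
  with good (balanced ℓ c e) over (balanced-zero-sum ℓ c e) long
  where
  over : SeqOver k (balanced ℓ c e)
  over = ++⁺ (replicate⁺ (ℓ * e) (InI-+ c≤k)) (replicate⁺ (ℓ * c) (InI-- e≤k))
  long : ℓ ≤ length (balanced ℓ c e)
  long = begin
    ℓ                                  ≡⟨ *-identityʳ ℓ ⟨
    ℓ * 1                              ≤⟨ *-monoʳ-≤ ℓ 1≤e ⟩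
    ℓ * e                              ≡⟨ length-replicate (ℓ * e) ⟨
    length (replicate (ℓ * e) (+ c))   ≤⟨ m≤m+n _ _ ⟩
    length (replicate (ℓ * e) (+ c)) + length (replicate (ℓ * c) (- + e))
                                       ≡⟨ length-++ (replicate (ℓ * e) (+ c)) ⟨
    length (balanced ℓ c e)            ∎
    where open ≤-Reasoning
... | T , T⊆ , T-zero , T-len with σ-three-valued T (All-resp-⊆ T⊆ two-valued)
  where
  two-valued : All (λ x → x ≡ + c ⊎ x ≡ - + e ⊎ x ≡ - + e) (balanced ℓ c e)
  two-valued = ++⁺ (replicate⁺ (ℓ * e) (inj₁ refl)) (replicate⁺ (ℓ * c) (inj₂ (inj₁ refl)))
... | p , q , r , p+q+r≡ , σT≡ = divides (q + r) (begin
  c * t                       ≡⟨ cong (c *_) (trans (sym T-len) (sym p+q+r≡)) ⟩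
  c * (p + q + r)             ≡⟨ expand c p q r ⟩
  p * c + (q + r) * c         ≡⟨ cong (_+ (q + r) * c) (balance p q r c e (trans (sym σT≡) T-zero)) ⟩
  (q + r) * e + (q + r) * c   ≡⟨ collect (q + r) c e ⟩
  (q + r) * (c + e)           ∎)
  where
  open ≡-Reasoning
  expand : ∀ c p q r → c * (p + q + r) ≡ p * c + (q + r) * c
  expand = solve-∀
  collect : ∀ s c e → s * e + s * c ≡ s * (c + e)
  collect = solve-∀

∣-consecutive-multiples : ∀ {d c t} → d ∣ c * t → d ∣ suc c * t → d ∣ t
∣-consecutive-multiples {d} {c} {t} d∣ct d∣[1+c]t = ∣m+n∣m⇒∣n (subst (d ∣_) (+-comm t (c * t)) d∣[1+c]t) d∣ct

Good⇒∣-pair-sum : ∀ {k t ℓ c e} → Good k t ℓ → suc c ≤ k → 1 ≤ e → suc e ≤ k → suc (c + e) ∣ t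
Good⇒∣-pair-sum {t = t} {c = c} {e} good 1+c≤k 1≤e 1+e≤k = ∣-consecutive-multiples {c = c}
  (subst (_∣ c * t) (+-suc c e) (Good⇒+∣*t good (≤-trans (n≤1+n c) 1+c≤k) (s≤s z≤n) 1+e≤k))
  (Good⇒+∣*t good 1+c≤k 1≤e (≤-trans (n≤1+n e) 1+e≤k))

2[1+n]≡2+2n : ∀ n → 2 * suc n ≡ suc (suc (n + n))
2[1+n]≡2+2n n = cong suc (trans (cong (_+_ n) (+-identityʳ (suc n))) (+-suc n n))

2[1+n]∸1≡1+2n : ∀ n → 2 * suc n ∸ 1 ≡ suc (n + n)
2[1+n]∸1≡1+2n n = cong pred (2[1+n]≡2+2n n)

-- Every d ∈ [3, 2k − 1] is c + e + 1 with c + 1 ≤ k and 1 ≤ e, e + 1 ≤ k: take c = 0 when d ≤ k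
-- and c = d − k, e = k − 1 otherwise.
pair-sum-decomposition : ∀ k′ d → 3 ≤ d → d ≤ suc (k′ + k′) →
  ∃[ c ] ∃[ e ] suc c ≤ suc k′ × 1 ≤ e × suc e ≤ suc k′ × d ≡ suc (c + e)
pair-sum-decomposition k′ (suc e) 3≤d d≤ with suc e ≤? suc k′
... | yes d≤k = 0 , e , s≤s z≤n , ≤-trans (s≤s z≤n) (≤-pred 3≤d) , d≤k , refl
... | no d≰k with m≤n⇒∃[o]m+o≡n (≰⇒> d≰k)
...   | f , k+1+f≡d = suc f , k′ , s≤s 1+f≤k′ , ≤-trans (s≤s z≤n) 1+f≤k′ , ≤-refl , d≡
  where
  1+f≤k′ : suc f ≤ k′
  1+f≤k′ = +-cancelˡ-≤ k′ (suc f) k′ (begin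
    k′ + suc f        ≡⟨ +-suc k′ f ⟩
    suc (k′ + f)      ≡⟨ suc-injective k+1+f≡d ⟩
    e                 ≤⟨ ≤-pred d≤ ⟩
    k′ + k′           ∎)
    where open ≤-Reasoning
  d≡ : suc e ≡ suc (suc f + k′)
  d≡ = begin
    suc e              ≡⟨ k+1+f≡d ⟨
    suc (suc k′ + f)   ≡⟨ cong suc (+-comm (suc k′) f) ⟩
    suc (f + suc k′)   ≡⟨ cong suc (+-suc f k′) ⟩
    suc (suc f + k′)   ∎
    where open ≡-Reasoning

Good⇒∣ : ∀ {k t ℓ} → 1 ≤ k → Good k t ℓ → ∀ d → 1 ≤ d → d ≤ D k → d ∣ t
Good⇒∣ {t = t} _ good 1 _ _ = 1∣ t
Good⇒∣ {t = t} 1≤k good 2 _ _ = subst (2 ∣_) (*-identityˡ t) (Good⇒+∣*t good 1≤k ≤-refl 1≤k)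
Good⇒∣ {suc k′} {t} _ good d@(suc (suc (suc _))) _ d≤D
  with pair-sum-decomposition k′ d (s≤s (s≤s (s≤s z≤n))) d≤2k-1
  where
  d≤2k-1 : d ≤ suc (k′ + k′)
  d≤2k-1 with ⊔-sel 2 (2 * suc k′ ∸ 1)
  ... | inj₁ D≡2 = ⊥-elim (<⇒≱ (s≤s (s≤s (s≤s z≤n))) (subst (d ≤_) D≡2 d≤D))
  ... | inj₂ D≡2k-1 = subst (d ≤_) (trans D≡2k-1 (2[1+n]∸1≡1+2n k′)) d≤D
... | c , e , 1+c≤k , 1≤e , 1+e≤k , d≡ = subst (_∣ t) (sym d≡) (Good⇒∣-pair-sum good 1+c≤k 1≤e 1+e≤k)

-- The lower bound

-- Reducing modulo m + 1 forces m ≤ u, which makes the left-hand side too large.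
no-short-complement : ∀ m u v → u * (2 + m) + v * (1 + m) + 1 ≢ (1 + m) * m
no-short-complement m u v eq = <⇒≢ too-large (sym eq)
  where
  regroup : ∀ u v m → u * (2 + m) + v * (1 + m) + 1 ≡ (u + v) * (1 + m) + suc u
  regroup = solve-∀
  m≤u : m ≤ u
  m≤u = ≤-pred (∣⇒≤ (∣m+n∣m⇒∣n (subst (suc m ∣_) (trans (sym eq) (regroup u v m)) (m∣m*n m))
                                (n∣m*n (u + v))))
  too-large : (1 + m) * m < u * (2 + m) + v * (1 + m) + 1
  too-large = begin-strict
    (1 + m) * m                          <⟨ m<m+n _ (s≤s z≤n) ⟩
    (1 + m) * m + suc m                  ≡⟨ expand m ⟩
    m * (2 + m) + 1                      ≤⟨ +-monoˡ-≤ 1 (*-monoˡ-≤ (2 + m) m≤u) ⟩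
    u * (2 + m) + 1                      ≤⟨ +-monoˡ-≤ 1 (m≤m+n _ _) ⟩
    u * (2 + m) + v * (1 + m) + 1        ∎
    where
    open ≤-Reasoning
    expand : ∀ m → (1 + m) * m + suc m ≡ m * (2 + m) + 1
    expand = solve-∀

lower-witness : ℕ → ℕ → ℕ → List ℤ
lower-witness m x y = replicate x (+ suc m) ++ replicate y (+ m) ++ replicate (x * suc m + y * m) -1ℤ

module _ (m x y : ℕ) where
  private
    S = lower-witness m x y
    z = x * suc m + y * m

  lower-witness-over : SeqOver (suc m) S
  lower-witness-over = ++⁺ (replicate⁺ x (InI-+ ≤-refl))
    (++⁺ (replicate⁺ y (InI-+ (n≤1+n m))) (replicate⁺ z (InI-- (s≤s z≤n))))

  lower-witness-values : All (λ s → s ≡ + suc m ⊎ s ≡ + m ⊎ s ≡ -1ℤ) S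
  lower-witness-values = ++⁺ (replicate⁺ x (inj₁ refl))
    (++⁺ (replicate⁺ y (inj₂ (inj₁ refl))) (replicate⁺ z (inj₂ (inj₂ refl))))

  lower-witness-zero-sum : ZeroSum S
  lower-witness-zero-sum = begin
    σ S
      ≡⟨ trans (σ-++ (replicate x (+ suc m)) _) (cong (σ (replicate x (+ suc m)) +ℤ_) (σ-++ (replicate y (+ m)) _)) ⟩
    σ (replicate x (+ suc m)) +ℤ (σ (replicate y (+ m)) +ℤ σ (replicate z -1ℤ))
      ≡⟨ cong₂ _+ℤ_ (σ-replicate x (+ suc m)) (cong₂ _+ℤ_ (σ-replicate y (+ m)) (σ-replicate z -1ℤ)) ⟩
    + x *ℤ + suc m +ℤ (+ y *ℤ + m +ℤ + z *ℤ -1ℤ)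
      ≡⟨ cong (λ n → + x *ℤ + suc m +ℤ (+ y *ℤ + m +ℤ n *ℤ -1ℤ))
           (trans (ℤ.pos-+ (x * suc m) (y * m)) (cong₂ _+ℤ_ (ℤ.pos-* x (suc m)) (ℤ.pos-* y m))) ⟩
    + x *ℤ + suc m +ℤ (+ y *ℤ + m +ℤ (+ x *ℤ + suc m +ℤ + y *ℤ + m) *ℤ -1ℤ)
      ≡⟨ cancel (+ x *ℤ + suc m) (+ y *ℤ + m) ⟩
    0ℤ ∎
    where
    open ≡-Reasoning
    cancel : ∀ a b → a +ℤ (b +ℤ (a +ℤ b) *ℤ -1ℤ) ≡ 0ℤ
    cancel = ℤ-Ring.solve-∀

  lower-witness-length : length S ≡ x * (2 + m) + y * (1 + m)
  lower-witness-length = begin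
    length S
      ≡⟨ trans (length-++ (replicate x (+ suc m))) (cong (_+_ _) (length-++ (replicate y (+ m)))) ⟩
    length (replicate x (+ suc m)) + (length (replicate y (+ m)) + length (replicate z -1ℤ))
      ≡⟨ cong₂ _+_ (length-replicate x) (cong₂ _+_ (length-replicate y) (length-replicate z)) ⟩
    x + (y + (x * suc m + y * m))
      ≡⟨ collect x y m ⟩
    x * (2 + m) + y * (1 + m) ∎
    where
    open ≡-Reasoning
    collect : ∀ x y m → x + (y + (x * suc m + y * m)) ≡ x * (2 + m) + y * (1 + m)
    collect = solve-∀

count-balance : ∀ p q r m → + p *ℤ + suc m +ℤ + q *ℤ + m +ℤ + r *ℤ -1ℤ ≡ 0ℤ → r ≡ p * suc m + q * m
count-balance p q r m sum≡0 = ℤ.+-injective (begin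
  + r                                                     ≡⟨ ℤ.+-identityˡ (+ r) ⟨
  0ℤ +ℤ + r                                               ≡⟨ cong (_+ℤ + r) sum≡0 ⟨
  + p *ℤ + suc m +ℤ + q *ℤ + m +ℤ + r *ℤ -1ℤ +ℤ + r       ≡⟨ cancel (+ p *ℤ + suc m) (+ q *ℤ + m) (+ r) ⟩
  + p *ℤ + suc m +ℤ + q *ℤ + m                            ≡⟨ cong₂ _+ℤ_ (ℤ.pos-* p (suc m)) (ℤ.pos-* q m) ⟨
  + (p * suc m + q * m)                                   ∎)
  where
  open ≡-Reasoning
  cancel : ∀ a b r → a +ℤ b +ℤ r *ℤ -1ℤ +ℤ r ≡ a +ℤ b
  cancel = ℤ-Ring.solve-∀

-- The complement of a zero-sum subsequence of length t in the witness is a zero-sum sequence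
-- over {m + 1, m, −1} of length (m + 1)m − 1, which cannot exist.
Good⇒¬lower-witness : ∀ {m t ℓ} x y → Good (suc m) t ℓ → ℓ ≤ x * (2 + m) + y * (1 + m) →
  x * (2 + m) + y * (1 + m) + 1 ≢ t + (1 + m) * m
Good⇒¬lower-witness {m} {t} x y good ℓ≤ eq
  with good (lower-witness m x y) (lower-witness-over m x y) (lower-witness-zero-sum m x y)
            (subst (_ ≤_) (sym (lower-witness-length m x y)) ℓ≤)
... | T , T⊆S , T-zero , T-len with ⊆⇒++-↭ T⊆S
... | C , T++C↭S with σ-three-valued C (proj₂ (++⁻ T (All-resp-↭ (↭-sym T++C↭S) (lower-witness-values m x y))))
... | p , q , r , p+q+r≡ , σC≡ = no-short-complement m p q (+-cancelˡ-≡ t _ _ (begin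
  t + (p * (2 + m) + q * (1 + m) + 1)   ≡⟨ cong (λ n → t + (n + 1)) C-length ⟩
  t + (length C + 1)                    ≡⟨ cong (_+ (length C + 1)) T-len ⟨
  length T + (length C + 1)             ≡⟨ +-assoc (length T) (length C) 1 ⟨
  length T + length C + 1               ≡⟨ cong (_+ 1) (length-++ T) ⟨
  length (T ++ C) + 1                   ≡⟨ cong (_+ 1) (↭-length T++C↭S) ⟩
  length (lower-witness m x y) + 1      ≡⟨ cong (_+ 1) (lower-witness-length m x y) ⟩
  x * (2 + m) + y * (1 + m) + 1         ≡⟨ eq ⟩
  t + (1 + m) * m                       ∎))
  where
  open ≡-Reasoning
  C-zero : ZeroSum C
  C-zero = trans (σ-complement T T++C↭S (lower-witness-zero-sum m x y)) (cong -_ T-zero)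
  regroup : ∀ p q m → p * (2 + m) + q * (1 + m) ≡ p + q + (p * suc m + q * m)
  regroup = solve-∀
  C-length : p * (2 + m) + q * (1 + m) ≡ length C
  C-length = trans (regroup p q m)
    (trans (cong (_+_ (p + q)) (sym (count-balance p q r m (trans (sym σC≡) C-zero)))) p+q+r≡)

-- Writing t − 1 = r + q(m + 1) with r + s = m, the witness with x = r and y = q + s has
-- length t − 1 + (m + 1)m.
lower-witness-fits : ∀ {m t′} r s q → r + s ≡ m → t′ ≡ r + q * suc m →
  r * (2 + m) + (q + s) * (1 + m) + 1 ≡ suc t′ + (1 + m) * m
lower-witness-fits r s q refl refl = expand r s q
  where
  expand : ∀ r s q → r * (2 + (r + s)) + (q + s) * (1 + (r + s)) + 1 ≡
                     suc (r + q * suc (r + s)) + (1 + (r + s)) * (r + s)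
  expand = solve-∀

Good⇒lower-bound : ∀ {k t ℓ} → 1 ≤ k → 1 ≤ t → Good k t ℓ → t + k * (k ∸ 1) ≤ ℓ
Good⇒lower-bound {suc m} {suc t′} {ℓ} _ _ good with suc t′ + suc m * m ≤? ℓ
... | yes bound = bound
... | no ¬bound with m≤n⇒∃[o]m+o≡n (≤-pred (m%n<n t′ (suc m)))
... | s , r+s≡m = ⊥-elim (Good⇒¬lower-witness r (q + s) good ℓ≤ fits)
  where
  r = t′ % suc m
  q = t′ / suc m
  fits : r * (2 + m) + (q + s) * (1 + m) + 1 ≡ suc t′ + (1 + m) * m
  fits = lower-witness-fits r s q r+s≡m (m≡m%n+[m/n]*n t′ (suc m))
  ℓ≤ : ℓ ≤ r * (2 + m) + (q + s) * (1 + m)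
  ℓ≤ = ≤-pred (subst (suc ℓ ≤_) (trans (sym fits) (+-comm _ 1)) (≰⇒> ¬bound))

-- Short zero-sum blocks

ShortBlock : ℕ → List ℤ → Set
ShortBlock n B = ZeroSum B × 1 ≤ length B × length B ≤ n

HasShortBlock : ℕ → List ℤ → Set
HasShortBlock n S = ∃₂ λ B R → B ++ R ↭ S × ShortBlock n B

InI? : ∀ m x → Dec (InI m x)
InI? m x = (- + m ℤ.≤? x) ×-dec (x ℤ.≤? + m)

offset : ℕ → ℤ → ℕ
offset m s = ℤ.∣ s +ℤ + m ∣

offset-nonneg : ∀ {m s} → InI m s → + offset m s ≡ s +ℤ + m
offset-nonneg {m} (-m≤s , _) = ℤ.0≤i⇒+∣i∣≡i
  (ℤ.≤-trans (ℤ.≤-reflexive (sym (ℤ.+-inverseˡ (+ m)))) (ℤ.+-monoˡ-≤ (+ m) -m≤s))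

offset< : ∀ {m s} → InI m s → offset m s < suc (m + m)
offset< {m} {s} s∈ = s≤s (ℤ.drop‿+≤+ (begin
  + offset m s     ≡⟨ offset-nonneg s∈ ⟩
  s +ℤ + m         ≤⟨ ℤ.+-monoˡ-≤ (+ m) (proj₂ s∈) ⟩
  + m +ℤ + m       ∎))
  where open ℤ.≤-Reasoning

offset-injective : ∀ {m s s′} → InI m s → InI m s′ → offset m s ≡ offset m s′ → s ≡ s′
offset-injective {m} s∈ s′∈ eq =
  +ℤ-cancelʳ _ _ (+ m) (trans (sym (offset-nonneg s∈)) (trans (cong +_ eq) (offset-nonneg s′∈)))

InI-step-up : ∀ {m s q} → InI m s → InI (suc m) q → s <ℤ 0ℤ → 0ℤ <ℤ q → InI m (q +ℤ s)
InI-step-up {m} {s} {q@(+ _)} (-m≤s , _) (_ , q≤) ℤ.-<+ _ =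
  ℤ.≤-trans -m≤s (ℤ.i≤j⇒i≤k+j q ℤ.≤-refl) , ℤ.+-mono-≤ q≤ (ℤ.-≤- z≤n)

InI-step-down : ∀ {m s q} → InI m s → InI (suc m) q → 0ℤ <ℤ s → q <ℤ 0ℤ → InI m (q +ℤ s)
InI-step-down {m} {s} {q} (_ , s≤m) (-m-1≤q , _) (ℤ.+<+ (s≤s z≤n)) q<0 =
  ℤ.≤-trans (ℤ.≤-reflexive (sym (shift-by-one (+ m)))) (ℤ.+-mono-≤ -m-1≤q (ℤ.+≤+ (s≤s z≤n))) ,
  ℤ.≤-trans (ℤ.+-monoˡ-≤ s (ℤ.<⇒≤ q<0)) (ℤ.≤-trans (ℤ.≤-reflexive (ℤ.+-identityˡ s)) s≤m)
  where
  shift-by-one : ∀ m → - (+ 1 +ℤ m) +ℤ + 1 ≡ - m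
  shift-by-one = ℤ-Ring.solve-∀

σ-positive⇒Any : ∀ L → 0ℤ <ℤ σ L → Any (0ℤ <ℤ_) L
σ-positive⇒Any [] (ℤ.+<+ ())
σ-positive⇒Any (x ∷ L) 0<σ with 0ℤ ℤ.<? x
... | yes 0<x = here 0<x
... | no 0≮x = there (σ-positive⇒Any L (ℤ.<-≤-trans 0<σ
        (ℤ.≤-trans (ℤ.+-monoˡ-≤ (σ L) (ℤ.≮⇒≥ 0≮x)) (ℤ.≤-reflexive (ℤ.+-identityˡ (σ L))))))

σ-negative⇒Any : ∀ L → σ L <ℤ 0ℤ → Any (_<ℤ 0ℤ) L
σ-negative⇒Any [] (ℤ.+<+ ())
σ-negative⇒Any (x ∷ L) σ<0 with x ℤ.<? 0ℤ
... | yes x<0 = here x<0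
... | no x≮0 = there (σ-negative⇒Any L (ℤ.≤-<-trans
        (ℤ.≤-trans (ℤ.≤-reflexive (sym (ℤ.+-identityˡ (σ L)))) (ℤ.+-monoˡ-≤ (σ L) (ℤ.≮⇒≥ x≮0))) σ<0))

InI-boundary : ∀ {m x} → InI (suc m) x → ¬ InI m x → x ≡ + suc m ⊎ x ≡ - + suc m
InI-boundary {m} {+ n} (_ , ℤ.+≤+ n≤1+m) ∉ with n ≤? m
... | yes n≤m = ⊥-elim (∉ (InI-+ n≤m))
... | no n≰m = inj₁ (cong +_ (≤-antisym n≤1+m (≰⇒> n≰m)))
InI-boundary {m} { -[1+ n ]} (ℤ.-≤- n≤m , _) ∉ with suc n ≤? m
... | yes 1+n≤m = ⊥-elim (∉ (InI-- 1+n≤m))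
... | no 1+n≰m = inj₂ (cong -[1+_] (≤-antisym n≤m (≤-pred (≰⇒> 1+n≰m))))

-- The walk lists its terms newest first, so the suffix sums of P are its partial sums.
Window : ℕ → List ℤ → Set
Window m P = ∀ i → InI m (σ (drop i P))

Window-[] : ∀ {m} → Window m []
Window-[] {m} i = subst (InI m ∘ σ) (sym (drop-[] i)) (InI-+ z≤n)

Window-∷ : ∀ {m q P} → InI m (q +ℤ σ P) → Window m P → Window m (q ∷ P)
Window-∷ q+σP∈ _      zero    = q+σP∈
Window-∷ _     window (suc i) = window i

-- Two of the 2m + 2 partial sums coincide.
window-pigeonhole : ∀ m P → length P ≡ suc (m + m) → Window m P →
  ∃₂ λ sg rest → sg ++ rest ↭ P × ShortBlock (suc (m + m)) sg
window-pigeonhole m P len window =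
  let i , j , sg , rest , drop≡ , sg++rest↭P , 1≤len , len≤ , offset≡ =
        infix-pigeonhole (suc (m + m)) (λ xs → offset m (σ xs)) P (≤-reflexive (sym len)) (λ i _ → offset< (window i))
  in sg , rest , sg++rest↭P ,
     σ-++≡σʳ⇒ZeroSum sg (drop j P) (trans (cong σ (sym drop≡)) (offset-injective (window i) (window j) offset≡)) ,
     1≤len , len≤

module Walk (m : ℕ) {S : List ℤ} (S-over : SeqOver (suc m) S) (S-zero : ZeroSum S) where

  private
    next-over : ∀ {P R q R′} → P ++ R ↭ S → q ∷ R′ ↭ R → InI (suc m) q
    next-over {P} P++R↭S q∷R′↭R =
      All.head (All-resp-↭ (↭-sym q∷R′↭R) (proj₂ (++⁻ P (All-resp-↭ (↭-sym P++R↭S) S-over))))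

    extend : ∀ {P R q R′} → P ++ R ↭ S → q ∷ R′ ↭ R → (q ∷ P) ++ R′ ↭ S
    extend {P} {q = q} {R′} P++R↭S q∷R′↭R =
      ↭-trans (↭-sym (shift q P R′)) (↭-trans (++⁺ˡ P q∷R′↭R) P++R↭S)

  -- Keep the partial sums in [−m, m] by adding a positive term while the sum is negative and a
  -- negative one while it is positive.
  walk : ∀ n P R → n + length P ≡ suc (m + m) → 1 ≤ length P → P ++ R ↭ S → Window m P →
    HasShortBlock (suc (m + m)) S
  walk zero P R len _ P++R↭S window =
    let sg , rest , sg++rest↭P , sg-block = window-pigeonhole m P len window
    in sg , rest ++ R , ↭-trans (↭-reflexive (sym (++-assoc sg rest R))) (↭-trans (++⁺ʳ R sg++rest↭P) P++R↭S) ,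
       sg-block
  walk (suc n) P R len 1≤len P++R↭S window = step (ℤ.<-cmp (σ P) 0ℤ)
    where
    σR≡-σP : σ R ≡ - σ P
    σR≡-σP = σ-complement P P++R↭S S-zero

    continue : ∀ {q R′} → q ∷ R′ ↭ R → InI m (q +ℤ σ P) → HasShortBlock (suc (m + m)) S
    continue q∷R′↭R q+σP∈ =
      walk n (_ ∷ P) _ (trans (+-suc n _) len) (s≤s z≤n) (extend P++R↭S q∷R′↭R) (Window-∷ q+σP∈ window)

    step : Tri (σ P <ℤ 0ℤ) (σ P ≡ 0ℤ) (0ℤ <ℤ σ P) → HasShortBlock (suc (m + m)) S
    step (tri≈ _ σP≡0 _) = P , R , P++R↭S , σP≡0 , 1≤len , subst (length P ≤_) len (m≤n+m _ (suc n))
    step (tri< σP<0 _ _) =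
      let q , R′ , 0<q , q∷R′↭R = Any-extract (σ-positive⇒Any R (subst (0ℤ <ℤ_) (sym σR≡-σP) (ℤ.neg-mono-< σP<0)))
      in continue q∷R′↭R (InI-step-up (window 0) (next-over P++R↭S q∷R′↭R) σP<0 0<q)
    step (tri> _ _ 0<σP) =
      let q , R′ , q<0 , q∷R′↭R = Any-extract (σ-negative⇒Any R (subst (_<ℤ 0ℤ) (sym σR≡-σP) (ℤ.neg-mono-< 0<σP)))
      in continue q∷R′↭R (InI-step-down (window 0) (next-over P++R↭S q∷R′↭R) 0<σP q<0)

1+2m≤D : ∀ m → suc (m + m) ≤ D (suc m)
1+2m≤D m = subst (_≤ D (suc m)) (2[1+n]∸1≡1+2n m) (m≤n⊔m 2 (2 * suc m ∸ 1))

2≤D : ∀ k → 2 ≤ D k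
2≤D k = m≤m⊔n 2 (2 * k ∸ 1)

HasShortBlock-mono : ∀ {n n′ S} → n ≤ n′ → HasShortBlock n S → HasShortBlock n′ S
HasShortBlock-mono n≤n′ (B , R , B++R↭S , B-zero , 1≤len , len≤) = B , R , B++R↭S , B-zero , 1≤len , ≤-trans len≤ n≤n′

boundary-pair : ∀ m x S → All (λ y → y ≡ + suc m ⊎ y ≡ - + suc m) (x ∷ S) → ZeroSum (x ∷ S) →
  HasShortBlock 2 (x ∷ S)
boundary-pair m x S (inj₁ refl ∷ S-boundary) x∷S-zero
  with Any-extract (σ-negative⇒Any S (subst (_<ℤ 0ℤ) (sym (σ-tail x S x∷S-zero)) ℤ.-<+))
... | y , S′ , y<0 , y∷S′↭S with All.head (All-resp-↭ (↭-sym y∷S′↭S) S-boundary)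
...   | inj₁ refl = ⊥-elim (ℤ.<-asym y<0 (ℤ.+<+ (s≤s z≤n)))
...   | inj₂ refl = x ∷ y ∷ [] , S′ , prep x y∷S′↭S , ℤ.+-inverseʳ x , s≤s z≤n , ≤-refl
boundary-pair m x S (inj₂ refl ∷ S-boundary) x∷S-zero
  with Any-extract (σ-positive⇒Any S (subst (0ℤ <ℤ_) (sym (σ-tail x S x∷S-zero)) (ℤ.+<+ (s≤s z≤n))))
... | y , S′ , 0<y , y∷S′↭S with All.head (All-resp-↭ (↭-sym y∷S′↭S) S-boundary)
...   | inj₁ refl = x ∷ y ∷ [] , S′ , prep x y∷S′↭S , trans (cong (x +ℤ_) (ℤ.+-identityʳ y)) (ℤ.+-inverseˡ y) , s≤s z≤n , ≤-refl
...   | inj₂ refl = ⊥-elim (ℤ.<-asym 0<y ℤ.-<+)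

-- If some term lies in [−m, m] the walk starts there; otherwise every term is ±(m + 1).
short-block : ∀ m {S} → SeqOver (suc m) S → ZeroSum S → 1 ≤ length S → HasShortBlock (D (suc m)) S
short-block m {S} S-over S-zero _ with any? (InI? m) S
... | yes some-small with Any-extract some-small
...   | p , S′ , p∈ , p∷S′↭S = HasShortBlock-mono (1+2m≤D m)
  (Walk.walk m S-over S-zero (m + m) (p ∷ []) S′ (+-comm (m + m) 1) (s≤s z≤n) p∷S′↭S
    (Window-∷ (subst (InI m) (sym (ℤ.+-identityʳ p)) p∈) Window-[]))
short-block m {x ∷ S′} S-over S-zero _ | no none-small = HasShortBlock-mono (2≤D (suc m))
  (boundary-pair m x S′ (All.zipWith (λ (y∈ , y∉) → InI-boundary y∈ y∉) (S-over , ¬Any⇒All¬ _ none-small)) S-zero)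

block-decomposition : ∀ m n S → length S ≤ n → SeqOver (suc m) S → ZeroSum S →
  ∃[ Bs ] concat Bs ↭ S × All (ShortBlock (D (suc m))) Bs
block-decomposition m n [] _ _ _ = [] , ↭-refl , []
block-decomposition m (suc n) S@(_ ∷ _) |S|≤ S-over S-zero with short-block m S-over S-zero (s≤s z≤n)
... | B , R , B++R↭S , B-block@(B-zero , 1≤|B| , _) with block-decomposition m n R |R|≤n R-over R-zero
  where
  |R|≤n : length R ≤ n
  |R|≤n = ≤-pred (begin-strict
    length R                <⟨ m<n+m (length R) 1≤|B| ⟩
    length B + length R     ≡⟨ length-++ B ⟨
    length (B ++ R)         ≡⟨ ↭-length B++R↭S ⟩
    length S                ≤⟨ |S|≤ ⟩
    suc n                   ∎)
    where open ≤-Reasoning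
  R-over : SeqOver (suc m) R
  R-over = proj₂ (++⁻ B (All-resp-↭ (↭-sym B++R↭S) S-over))
  R-zero : ZeroSum R
  R-zero = trans (σ-complement B B++R↭S S-zero) (cong -_ B-zero)
... | Bs , concat-Bs↭R , Bs-blocks = B ∷ Bs , ↭-trans (++⁺ˡ B concat-Bs↭R) B++R↭S , B-block ∷ Bs-blocks

-- Subset sums of bounded weights

%-≡⇒∣ : ∀ v .{{_ : NonZero v}} a b → (a + b) % v ≡ b % v → v ∣ a
%-≡⇒∣ v a b eq = ∣m+n∣m⇒∣n (subst (v ∣_) (sym a+[b/v]v≡) (n∣m*n ((a + b) / v))) (n∣m*n (b / v))
  where
  open ≡-Reasoning
  a+[b/v]v≡ : b / v * v + a ≡ (a + b) / v * v
  a+[b/v]v≡ = +-cancelˡ-≡ (b % v) _ _ (begin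
    b % v + (b / v * v + a)          ≡⟨ +-assoc (b % v) _ a ⟨
    b % v + b / v * v + a            ≡⟨ cong (_+ a) (m≡m%n+[m/n]*n b v) ⟨
    b + a                            ≡⟨ +-comm b a ⟩
    a + b                            ≡⟨ m≡m%n+[m/n]*n (a + b) v ⟩
    (a + b) % v + (a + b) / v * v    ≡⟨ cong (_+ (a + b) / v * v) eq ⟩
    b % v + (a + b) / v * v          ∎)

triangular : ℕ → ℕ
triangular zero    = 0
triangular (suc n) = suc n + triangular n

2*triangular : ∀ n → 2 * triangular n ≡ n * suc n
2*triangular zero    = refl
2*triangular (suc n) = begin
  2 * (suc n + triangular n)      ≡⟨ *-distribˡ-+ 2 (suc n) (triangular n) ⟩
  2 * suc n + 2 * triangular n    ≡⟨ cong (_+_ (2 * suc n)) (2*triangular n) ⟩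
  2 * suc n + n * suc n           ≡⟨ collect n ⟩
  suc n * suc (suc n)             ∎
  where
  open ≡-Reasoning
  collect : ∀ n → 2 * suc n + n * suc n ≡ suc n * suc (suc n)
  collect = solve-∀

1+n-coprime-2+n : ∀ n → Coprime (suc n) (suc (suc n))
1+n-coprime-2+n n {d} (d∣1+n , d∣2+n) = ∣1⇒≡1 (∣m+n∣m⇒∣n (subst (d ∣_) (+-comm 1 (suc n)) d∣2+n) d∣1+n)

-- n + 2 is coprime to n + 3, and gcd(n + 1, (n + 2)(n + 3)) divides 2.
consecutive-divisors-bound : ∀ n t → 1 ≤ t → 3 + n ∣ t → 2 + n ∣ t → 1 + n ∣ t →
  (3 + n) * (2 + n) * (1 + n) ≤ 2 * t
consecutive-divisors-bound n t 1≤t (divides s t≡s[3+n]) 2+n∣t 1+n∣t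
  with coprime-divisor {o = s} (1+n-coprime-2+n (suc n)) (subst (2 + n ∣_) (trans t≡s[3+n] (*-comm s (3 + n))) 2+n∣t)
... | divides zero s≡0 = ⊥-elim (<⇒≢ 1≤t (sym (trans t≡s[3+n] (cong (_* (3 + n)) s≡0))))
... | divides s′@(suc _) s≡s′[2+n] = begin
    (3 + n) * (2 + n) * (1 + n)        ≤⟨ *-monoʳ-≤ ((3 + n) * (2 + n)) (∣⇒≤ 1+n∣2s′) ⟩
    (3 + n) * (2 + n) * (2 * s′)       ≡⟨ regroup s′ n ⟩
    2 * ((2 + n) * (s′ * (3 + n)))     ≡⟨ cong (2 *_) t≡ ⟨
    2 * t                              ∎
  where
  open ≤-Reasoning
  regroup : ∀ s n → (3 + n) * (2 + n) * (2 * s) ≡ 2 * ((2 + n) * (s * (3 + n)))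
  regroup = solve-∀
  regroup′ : ∀ s n → s * (2 + n) * (3 + n) ≡ (2 + n) * (s * (3 + n))
  regroup′ = solve-∀
  split : ∀ s n → s * (3 + n) ≡ s * (1 + n) + 2 * s
  split = solve-∀
  t≡ : t ≡ (2 + n) * (s′ * (3 + n))
  t≡ = trans t≡s[3+n] (trans (cong (_* (3 + n)) s≡s′[2+n]) (regroup′ s′ n))
  1+n∣2s′ : 1 + n ∣ 2 * s′
  1+n∣2s′ = ∣m+n∣m⇒∣n
    (subst (1 + n ∣_) (split s′ n) (coprime-divisor {o = s′ * (3 + n)} (1+n-coprime-2+n n) (subst (1 + n ∣_) t≡ 1+n∣t)))
    (n∣m*n s′)

-- If fewer than M′ − 1 terms have weight M′ + 1 and each weight v ≤ M′ occurs fewer than M′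
-- times, the total weight is too small, because t ≥ lcm(M′ − 1, M′, M′ + 1).
too-light : ∀ M′ c t W → 2 + c ≤ M′ → 1 ≤ t → (∀ d → 1 ≤ d → d ≤ suc M′ → d ∣ t) →
  W ≤ (M′ ∸ 1) * triangular M′ → t + M′ * (M′ ∸ 1) ≤ c * suc M′ + W → ⊥
too-light (suc (suc n)) c t W (s≤s (s≤s c≤n)) 1≤t ∣t W≤ heavy = <⇒≱ (m<m+n X (s≤s z≤n)) (begin
  X + 4                                              ≡⟨ expand n t ⟩
  2 * (t + (2 + n) * (1 + n))                        ≤⟨ *-monoʳ-≤ 2 heavy ⟩
  2 * (c * (3 + n) + W)                              ≡⟨ *-distribˡ-+ 2 (c * (3 + n)) W ⟩
  2 * (c * (3 + n)) + 2 * W                          ≤⟨ +-mono-≤ (*-monoʳ-≤ 2 (*-monoˡ-≤ (3 + n) c≤n)) (*-monoʳ-≤ 2 W≤) ⟩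
  2 * (n * (3 + n)) + 2 * ((1 + n) * T)              ≡⟨ cong (_+_ (2 * (n * (3 + n)))) (commute n T) ⟩
  2 * (n * (3 + n)) + (1 + n) * (2 * T)              ≡⟨ cong (λ x → 2 * (n * (3 + n)) + (1 + n) * x) (2*triangular (2 + n)) ⟩
  2 * (n * (3 + n)) + (1 + n) * ((2 + n) * (3 + n))  ≡⟨ cong (_+_ (2 * (n * (3 + n)))) (reorder n) ⟩
  2 * (n * (3 + n)) + (3 + n) * (2 + n) * (1 + n)    ≤⟨ +-monoʳ-≤ (2 * (n * (3 + n))) lcm-bound ⟩
  X                                                  ∎)
  where
  open ≤-Reasoning
  T = triangular (2 + n)
  X = 2 * (n * (3 + n)) + 2 * t
  lcm-bound : (3 + n) * (2 + n) * (1 + n) ≤ 2 * t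
  lcm-bound = consecutive-divisors-bound n t 1≤t (∣t (3 + n) (s≤s z≤n) ≤-refl) (∣t (2 + n) (s≤s z≤n) (n≤1+n _))
                (∣t (1 + n) (s≤s z≤n) (≤-trans (n≤1+n _) (n≤1+n _)))
  expand : ∀ n t → 2 * (n * (3 + n)) + 2 * t + 4 ≡ 2 * (t + (2 + n) * (1 + n))
  expand = solve-∀
  commute : ∀ n x → 2 * ((1 + n) * x) ≡ (1 + n) * (2 * x)
  commute = solve-∀
  reorder : ∀ n → (1 + n) * ((2 + n) * (3 + n)) ≡ (3 + n) * (2 + n) * (1 + n)
  reorder = solve-∀

slack-top : ∀ M′ → M′ * M′ < M′ * (M′ ∸ 1) + suc M′
slack-top zero    = s≤s z≤n
slack-top (suc a) = ≤-reflexive (expand a)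
  where
  expand : ∀ a → suc ((1 + a) * (1 + a)) ≡ (1 + a) * a + (2 + a)
  expand = solve-∀

slack-frequent : ∀ v M′ → 1 ≤ v → v ≤ M′ → (v ∸ 1) * suc M′ < M′ * (M′ ∸ 1) + v
slack-frequent (suc a) M′ _ v≤M′ with m≤n⇒∃[o]m+o≡n v≤M′
... | b , refl = ≤-trans (m≤m+n _ (a * b + b * b + b)) (≤-reflexive (expand a b))
  where
  expand : ∀ a b → suc (a * suc (suc a + b)) + (a * b + b * b + b) ≡ (suc a + b) * (a + b) + suc a
  expand = solve-∀

module Weighted {X : Set} (w : X → ℕ) where

  weight : List X → ℕ
  weight xs = sum (map w xs)

  weight-++ : ∀ xs ys → weight (xs ++ ys) ≡ weight xs + weight ys
  weight-++ xs ys = trans (cong sum (map-++ w xs ys)) (sum-++ (map w xs) (map w ys))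

  weight-↭ : {xs ys : List X} → xs ↭ ys → weight xs ≡ weight ys
  weight-↭ p = sum-↭ (↭.map⁺ w p)

  weight-≤ : ∀ {K} xs → All (λ x → w x ≤ K) xs → weight xs ≤ length xs * K
  weight-≤ []       []         = z≤n
  weight-≤ (x ∷ xs) (wx≤ ∷ ws≤) = +-mono-≤ wx≤ (weight-≤ xs ws≤)

  weight-≡ : ∀ {v} xs → All (λ x → w x ≡ v) xs → weight xs ≡ length xs * v
  weight-≡ []       []         = refl
  weight-≡ (x ∷ xs) (wx≡ ∷ ws≡) = cong₂ _+_ wx≡ (weight-≡ xs ws≡)

  SubsetSum : ℕ → List X → Set
  SubsetSum t xs = ∃₂ λ ys zs → ys ++ zs ↭ xs × weight ys ≡ t

  SubsetSum-↭ : ∀ {t xs xs′} → xs ↭ xs′ → SubsetSum t xs → SubsetSum t xs′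
  SubsetSum-↭ xs↭xs′ (ys , zs , ys++zs↭xs , weight≡t) = ys , zs , ↭-trans ys++zs↭xs xs↭xs′ , weight≡t

  below-excluded : ∀ {n ys} → All (λ x → w x ≤ suc n) ys → All (λ x → ¬ w x ≡ suc n) ys → All (λ x → w x ≤ n) ys
  below-excluded ≤1+n ≢1+n = All.zipWith (λ (le , ne) → ≤-pred (≤∧≢⇒< le ne)) (≤1+n , ≢1+n)

  greedy : ∀ K t R → All (λ x → w x ≤ K) R →
    ∃₂ λ R₁ R₂ → R₁ ++ R₂ ↭ R × weight R₁ ≤ t × (weight R₁ ≡ weight R ⊎ t < weight R₁ + K)
  greedy K t []       []          = [] , [] , ↭-refl , z≤n , inj₁ refl
  greedy K t (x ∷ R) (wx≤K ∷ R≤K) with greedy K t R R≤K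
  ... | R₁ , R₂ , R₁++R₂↭R , R₁≤t , inj₂ overflow =
    R₁ , x ∷ R₂ , ↭-trans (shift x R₁ R₂) (prep x R₁++R₂↭R) , R₁≤t , inj₂ overflow
  ... | R₁ , R₂ , R₁++R₂↭R , R₁≤t , inj₁ took-all with w x + weight R₁ ≤? t
  ...   | yes fits = x ∷ R₁ , R₂ , prep x R₁++R₂↭R , fits , inj₁ (cong (_+_ (w x)) took-all)
  ...   | no ¬fits = R₁ , x ∷ R₂ , ↭-trans (shift x R₁ R₂) (prep x R₁++R₂↭R) , R₁≤t ,
            inj₂ (≤-trans (≰⇒> ¬fits) (subst (w x + weight R₁ ≤_) (+-comm K _) (+-monoˡ-≤ (weight R₁) wx≤K)))

  -- Among v terms, two suffix weights agree modulo v, so the infix between them has weight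
  -- divisible by v; repeat until fewer than v terms remain.
  divisible-part : ∀ v .{{_ : NonZero v}} n R → length R ≤ n →
    ∃₂ λ Xs Ys → Xs ++ Ys ↭ R × v ∣ weight Xs × length Ys < v
  divisible-part v n R |R|≤n with length R <? v
  ... | yes short = [] , R , ↭-refl , divides 0 refl , short
  divisible-part v zero    [] _     | no ¬short = ⊥-elim (¬short (>-nonZero⁻¹ v))
  divisible-part v (suc n) R  |R|≤n | no ¬short
    with infix-pigeonhole v (λ xs → weight xs % v) R (≮⇒≥ ¬short) (λ i _ → m%n<n _ v)
  ... | i , j , sg , rest , drop≡ , sg++rest↭R , 1≤|sg| , _ , mod≡ with divisible-part v n rest |rest|≤n
    where
    |rest|≤n : length rest ≤ n
    |rest|≤n = ≤-pred (begin-strict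
      length rest                <⟨ m<n+m (length rest) 1≤|sg| ⟩
      length sg + length rest    ≡⟨ length-++ sg ⟨
      length (sg ++ rest)        ≡⟨ ↭-length sg++rest↭R ⟩
      length R                   ≤⟨ |R|≤n ⟩
      suc n                      ∎)
      where open ≤-Reasoning
  ... | Xs , Ys , Xs++Ys↭rest , v∣Xs , |Ys|<v =
    sg ++ Xs , Ys , ↭-trans (↭-reflexive (++-assoc sg Xs Ys)) (↭-trans (++⁺ˡ sg Xs++Ys↭rest) sg++rest↭R) ,
    subst (v ∣_) (sym (weight-++ sg Xs)) (∣m∣n⇒∣m+n v∣sg v∣Xs) , |Ys|<v
    where
    v∣sg : v ∣ weight sg
    v∣sg = %-≡⇒∣ v (weight sg) (weight (drop j R))
      (trans (cong (_% v) (sym (trans (cong weight drop≡) (weight-++ sg (drop j R))))) mod≡)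

  -- Greedily take from R a part R₁ of weight at most t, split off from R₁ a part Xs of weight
  -- divisible by v leaving fewer than v terms, and top Xs up to t with copies of v.
  fill-with-copies : ∀ {v K B t} (Vs R : List X) → 1 ≤ v → v ∣ t → (v ∸ 1) * K < B + v →
    K ≤ suc (length Vs) → All (λ x → w x ≡ v) Vs → All (λ x → w x ≤ K) R →
    t + B ≤ weight (Vs ++ R) → SubsetSum t (Vs ++ R)
  fill-with-copies {suc v′} {K} {B} {t} Vs R _ (divides a t≡av) slack K≤1+c Vs≡v R≤K heavy
    with greedy K t R R≤K
  ... | R₁ , R₂ , R₁++R₂↭R , R₁≤t , took with divisible-part (suc v′) (length R₁) R₁ ≤-refl
  ... | Xs , Ys , Xs++Ys↭R₁ , divides b WX≡bv , |Ys|<v =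
    Xs ++ take q Vs , Ys ++ R₂ ++ drop q Vs , perm , weight≡t
    where
    v = suc v′
    c = length Vs
    WX = weight Xs
    WY = weight Ys

    R₁≡ : weight R₁ ≡ WX + WY
    R₁≡ = trans (sym (weight-↭ Xs++Ys↭R₁)) (weight-++ Xs Ys)

    WY≤ : WY ≤ v′ * K
    WY≤ = ≤-trans (weight-≤ Ys (proj₂ (++⁻ Xs (All-resp-↭ (↭-sym Xs++Ys↭R₁)
                   (proj₁ (++⁻ R₁ (All-resp-↭ (↭-sym R₁++R₂↭R) R≤K)))))))
                  (*-monoˡ-≤ K (≤-pred |Ys|<v))

    b≤a : b ≤ a
    b≤a = *-cancelʳ-≤ b a v (subst₂ _≤_ WX≡bv t≡av (≤-trans (m≤m+n WX WY) (subst (_≤ t) R₁≡ R₁≤t)))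

    q = a ∸ b

    WX+qv≡t : WX + q * v ≡ t
    WX+qv≡t = begin
      WX + q * v     ≡⟨ cong (_+ q * v) WX≡bv ⟩
      b * v + q * v  ≡⟨ *-distribʳ-+ v b q ⟨
      (b + q) * v    ≡⟨ cong (_* v) (m+[n∸m]≡n b≤a) ⟩
      a * v          ≡⟨ t≡av ⟨
      t              ∎
      where open ≡-Reasoning

    q<1+c : weight R₁ ≡ weight R ⊎ t < weight R₁ + K → q * v < suc c * v
    q<1+c (inj₁ R₁≡R) = +-cancelʳ-< (WX + B) (q * v) (suc c * v) (begin-strict
      q * v + (WX + B)     ≡⟨ regroup (q * v) WX B ⟩
      (WX + q * v) + B     ≡⟨ cong (_+ B) WX+qv≡t ⟩
      t + B                ≤⟨ heavy ⟩
      weight (Vs ++ R)     ≡⟨ weight-++ Vs R ⟩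
      weight Vs + weight R ≡⟨ cong₂ _+_ (weight-≡ Vs Vs≡v) (trans (sym R₁≡R) R₁≡) ⟩
      c * v + (WX + WY)    ≤⟨ +-monoʳ-≤ (c * v) (+-monoʳ-≤ WX WY≤) ⟩
      c * v + (WX + v′ * K) <⟨ +-monoʳ-< (c * v) (+-monoʳ-< WX slack) ⟩
      c * v + (WX + (B + v)) ≡⟨ regroup′ c v WX B ⟩
      suc c * v + (WX + B) ∎)
      where
      open ≤-Reasoning
      regroup : ∀ x y z → x + (y + z) ≡ y + x + z
      regroup = solve-∀
      regroup′ : ∀ c v x y → c * v + (x + (y + v)) ≡ (1 + c) * v + (x + y)
      regroup′ = solve-∀
    q<1+c (inj₂ t<R₁+K) = +-cancelʳ-< WX (q * v) (suc c * v) (begin-strict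
      q * v + WX           ≡⟨ trans (+-comm (q * v) WX) WX+qv≡t ⟩
      t                    <⟨ t<R₁+K ⟩
      weight R₁ + K        ≡⟨ cong (_+ K) R₁≡ ⟩
      WX + WY + K          ≤⟨ +-monoˡ-≤ K (+-monoʳ-≤ WX WY≤) ⟩
      WX + v′ * K + K      ≡⟨ regroup WX v′ K ⟩
      v * K + WX           ≤⟨ +-monoˡ-≤ WX (*-monoʳ-≤ v K≤1+c) ⟩
      v * suc c + WX       ≡⟨ cong (_+ WX) (*-comm v (suc c)) ⟩
      suc c * v + WX       ∎)
      where
      open ≤-Reasoning
      regroup : ∀ x v′ K → x + v′ * K + K ≡ (1 + v′) * K + x
      regroup = solve-∀

    q≤c : q ≤ c
    q≤c = ≤-pred (*-cancelʳ-< v q (suc c) (q<1+c took))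

    weight≡t : weight (Xs ++ take q Vs) ≡ t
    weight≡t = begin
      weight (Xs ++ take q Vs)     ≡⟨ weight-++ Xs (take q Vs) ⟩
      WX + weight (take q Vs)      ≡⟨ cong (_+_ WX) (weight-≡ (take q Vs) (take⁺ q Vs≡v)) ⟩
      WX + length (take q Vs) * v  ≡⟨ cong (λ n → WX + n * v) (trans (length-take q Vs) (m≤n⇒m⊓n≡m q≤c)) ⟩
      WX + q * v                   ≡⟨ WX+qv≡t ⟩
      t                            ∎
      where open ≡-Reasoning

    perm : (Xs ++ take q Vs) ++ Ys ++ R₂ ++ drop q Vs ↭ Vs ++ R
    perm = begin
      (Xs ++ take q Vs) ++ Ys ++ R₂ ++ drop q Vs   ≡⟨ ++-assoc Xs (take q Vs) _ ⟩
      Xs ++ take q Vs ++ Ys ++ R₂ ++ drop q Vs     ↭⟨ shifts Xs (take q Vs) ⟩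
      take q Vs ++ Xs ++ Ys ++ R₂ ++ drop q Vs     ≡⟨ cong (take q Vs ++_) (++-assoc Xs Ys _) ⟨
      take q Vs ++ (Xs ++ Ys) ++ R₂ ++ drop q Vs   ↭⟨ ++⁺ˡ (take q Vs) (++⁺ʳ (R₂ ++ drop q Vs) Xs++Ys↭R₁) ⟩
      take q Vs ++ R₁ ++ R₂ ++ drop q Vs           ≡⟨ cong (take q Vs ++_) (++-assoc R₁ R₂ _) ⟨
      take q Vs ++ (R₁ ++ R₂) ++ drop q Vs         ↭⟨ ++⁺ˡ (take q Vs) (++⁺ʳ (drop q Vs) R₁++R₂↭R) ⟩
      take q Vs ++ R ++ drop q Vs                  ↭⟨ ++⁺ˡ (take q Vs) (++-comm R (drop q Vs)) ⟩
      take q Vs ++ drop q Vs ++ R                  ≡⟨ ++-assoc (take q Vs) (drop q Vs) R ⟨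
      (take q Vs ++ drop q Vs) ++ R                ≡⟨ cong (_++ R) (take++drop≡id q Vs) ⟩
      Vs ++ R                                      ∎
      where open PermutationReasoning

  frequent-or-light : ∀ θ n L → All (λ x → w x ≤ n) L →
    (∃[ v ] ∃₂ λ Vs Rs → 1 ≤ v × v ≤ n × Vs ++ Rs ↭ L × All (λ x → w x ≡ v) Vs ×
                          All (λ x → w x ≤ n) Rs × θ ≤ length Vs)
    ⊎ weight L ≤ (θ ∸ 1) * triangular n
  frequent-or-light θ zero L L≤0 =
    inj₂ (≤-trans (weight-≤ L L≤0) (≤-reflexive (trans (*-zeroʳ (length L)) (sym (*-zeroʳ (θ ∸ 1))))))
  frequent-or-light θ (suc n) L L≤1+n with partition-↭ (λ x → w x ≟ suc n) L
  ... | Vs , Rs , Vs++Rs↭L , Vs≡ , Rs≢ with θ ≤? length Vs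
  ... | yes frequent = inj₁ (suc n , Vs , Rs , s≤s z≤n , ≤-refl , Vs++Rs↭L , Vs≡ , Rs≤1+n , frequent)
    where
    Rs≤1+n : All (λ x → w x ≤ suc n) Rs
    Rs≤1+n = proj₂ (++⁻ Vs (All-resp-↭ (↭-sym Vs++Rs↭L) L≤1+n))
  ... | no ¬frequent with frequent-or-light θ n Rs Rs≤n
    where
    Rs≤n : All (λ x → w x ≤ n) Rs
    Rs≤n = below-excluded (proj₂ (++⁻ Vs (All-resp-↭ (↭-sym Vs++Rs↭L) L≤1+n))) Rs≢
  ... | inj₁ (v , Us , Ts , 1≤v , v≤n , Us++Ts↭Rs , Us≡v , Ts≤n , θ≤) =
    inj₁ (v , Us , Ts ++ Vs , 1≤v , m≤n⇒m≤1+n v≤n , perm , Us≡v ,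
          ++⁺ (All.map m≤n⇒m≤1+n Ts≤n) (All.map ≤-reflexive Vs≡) , θ≤)
    where
    perm : Us ++ Ts ++ Vs ↭ L
    perm = begin
      Us ++ Ts ++ Vs    ≡⟨ ++-assoc Us Ts Vs ⟨
      (Us ++ Ts) ++ Vs  ↭⟨ ++⁺ʳ Vs Us++Ts↭Rs ⟩
      Rs ++ Vs          ↭⟨ ++-comm Rs Vs ⟩
      Vs ++ Rs          ↭⟨ Vs++Rs↭L ⟩
      L                 ∎
      where open PermutationReasoning
  ... | inj₂ light = inj₂ (begin
    weight L                                    ≡⟨ weight-↭ Vs++Rs↭L ⟨
    weight (Vs ++ Rs)                           ≡⟨ weight-++ Vs Rs ⟩
    weight Vs + weight Rs                       ≡⟨ cong (_+ weight Rs) (weight-≡ Vs Vs≡) ⟩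
    length Vs * suc n + weight Rs               ≤⟨ +-mono-≤ (*-monoˡ-≤ (suc n) |Vs|≤θ-1) light ⟩
    (θ ∸ 1) * suc n + (θ ∸ 1) * triangular n    ≡⟨ *-distribˡ-+ (θ ∸ 1) (suc n) (triangular n) ⟨
    (θ ∸ 1) * triangular (suc n)                ∎)
    where
    open ≤-Reasoning
    |Vs|≤θ-1 : length Vs ≤ θ ∸ 1
    |Vs|≤θ-1 = <⇒≤pred (≰⇒> ¬frequent)

  -- Let M′ + 1 be the largest weight.  If it occurs at least M′ − 1 times, fill with copies of it;
  -- otherwise some smaller weight occurs at least M′ times unless the total is too small.
  subset-sum : ∀ M t xs → All (λ x → 1 ≤ w x × w x ≤ M) xs → (∀ d → 1 ≤ d → d ≤ M → d ∣ t) →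
    t + (M ∸ 1) * (M ∸ 2) ≤ weight xs → SubsetSum t xs
  subset-sum M zero xs _ _ _ = [] , xs , ↭-refl , refl
  subset-sum zero (suc t) [] _ _ ()
  subset-sum zero (suc t) (x ∷ xs) ((1≤wx , wx≤0) ∷ _) _ _ = ⊥-elim (<⇒≱ 1≤wx wx≤0)
  subset-sum (suc M′) t@(suc _) xs xs-bounds ∣t heavy with partition-↭ (λ x → w x ≟ suc M′) xs
  ... | Ms , Rs , Ms++Rs↭xs , Ms≡ , Rs≢ = SubsetSum-↭ Ms++Rs↭xs (by-top-count (M′ ≤? suc (length Ms)))
    where
    Rs≤M′ : All (λ x → w x ≤ M′) Rs
    Rs≤M′ = below-excluded (All.map proj₂ (proj₂ (++⁻ Ms (All-resp-↭ (↭-sym Ms++Rs↭xs) xs-bounds)))) Rs≢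

    heavy′ : t + M′ * (M′ ∸ 1) ≤ weight (Ms ++ Rs)
    heavy′ = subst (t + M′ * (M′ ∸ 1) ≤_) (sym (weight-↭ Ms++Rs↭xs)) heavy

    by-top-count : Dec (M′ ≤ suc (length Ms)) → SubsetSum t (Ms ++ Rs)
    by-top-count (yes many-tops) =
      fill-with-copies Ms Rs (s≤s z≤n) (∣t (suc M′) (s≤s z≤n) ≤-refl) (slack-top M′) many-tops Ms≡ Rs≤M′ heavy′
    by-top-count (no few-tops) with frequent-or-light M′ M′ Rs Rs≤M′
    ... | inj₁ (v , Vs , Us , 1≤v , v≤M′ , Vs++Us↭Rs , Vs≡v , Us≤M′ , M′≤|Vs|) = SubsetSum-↭ perm
      (fill-with-copies Vs (Us ++ Ms) 1≤v (∣t v 1≤v (m≤n⇒m≤1+n v≤M′)) (slack-frequent v M′ 1≤v v≤M′)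
        (s≤s M′≤|Vs|) Vs≡v (++⁺ (All.map m≤n⇒m≤1+n Us≤M′) (All.map ≤-reflexive Ms≡))
        (subst (t + M′ * (M′ ∸ 1) ≤_) (sym (weight-↭ perm)) heavy′))
      where
      perm : Vs ++ Us ++ Ms ↭ Ms ++ Rs
      perm = begin
        Vs ++ Us ++ Ms    ≡⟨ ++-assoc Vs Us Ms ⟨
        (Vs ++ Us) ++ Ms  ↭⟨ ++⁺ʳ Ms Vs++Us↭Rs ⟩
        Rs ++ Ms          ↭⟨ ++-comm Rs Ms ⟩
        Ms ++ Rs          ∎
        where open PermutationReasoning
    ... | inj₂ light = ⊥-elim (too-light M′ (length Ms) t (weight Rs) (≰⇒> few-tops) (s≤s z≤n) ∣t light (begin
      t + M′ * (M′ ∸ 1)              ≤⟨ heavy′ ⟩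
      weight (Ms ++ Rs)              ≡⟨ weight-++ Ms Rs ⟩
      weight Ms + weight Rs          ≡⟨ cong (_+ weight Rs) (weight-≡ Ms Ms≡) ⟩
      length Ms * suc M′ + weight Rs ∎))
      where open ≤-Reasoning

-- The upper bound

concat-↭ : {xss yss : List (List A)} → xss ↭ yss → concat xss ↭ concat yss
concat-↭ _↭_.refl          = ↭-refl
concat-↭ (prep xs p)       = ++⁺ˡ xs (concat-↭ p)
concat-↭ (swap xs ys p)    = ↭-trans (shifts xs ys) (++⁺ˡ ys (++⁺ˡ xs (concat-↭ p)))
concat-↭ (_↭_.trans p q)   = ↭-trans (concat-↭ p) (concat-↭ q)

length-concat : (Bs : List (List A)) → length (concat Bs) ≡ Weighted.weight length Bs
length-concat []       = refl
length-concat (B ∷ Bs) = trans (length-++ B) (cong (_+_ (length B)) (length-concat Bs))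

ZeroSum-concat : {Bs : List (List ℤ)} → All ZeroSum Bs → ZeroSum (concat Bs)
ZeroSum-concat []                          = refl
ZeroSum-concat {B ∷ Bs} (B-zero ∷ Bs-zero) = trans (σ-++ B (concat Bs)) (cong₂ _+ℤ_ B-zero (ZeroSum-concat Bs-zero))

[D∸1][D∸2] : ∀ m → (D (suc m) ∸ 1) * (D (suc m) ∸ 2) ≡ (2 * suc m ∸ 2) * (2 * suc m ∸ 3)
[D∸1][D∸2] zero    = refl
[D∸1][D∸2] (suc j) = trans (cong (λ x → (x ∸ 1) * (x ∸ 2)) D≡)
                            (cong (λ x → (x ∸ 2) * (x ∸ 3)) (sym (2[1+n]≡2+2n (suc j))))
  where
  D≡ : D (suc (suc j)) ≡ suc (suc j + suc j)
  D≡ = trans (cong (2 ⊔_) (2[1+n]∸1≡1+2n (suc j))) (m≤n⇒m⊔n≡n (s≤s (s≤s z≤n)))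

∣t⇒Good : ∀ {k t} → 1 ≤ k → (∀ d → 1 ≤ d → d ≤ D k → d ∣ t) → Good k t (t + (2 * k ∸ 2) * (2 * k ∸ 3))
∣t⇒Good {suc m} {t} _ ∣t S S-over S-zero long
  with block-decomposition m (length S) S ≤-refl S-over S-zero
... | Bs , concat-Bs↭S , blocks
  with Weighted.subset-sum length (D (suc m)) t Bs (All.map (λ (_ , 1≤ , ≤D) → 1≤ , ≤D) blocks) ∣t
         (subst₂ _≤_ (cong (_+_ t) (sym ([D∸1][D∸2] m))) (trans (sym (↭-length concat-Bs↭S)) (length-concat Bs)) long)
... | ys , zs , ys++zs↭Bs , |ys|≡t
  with ⊆-resp-↭ (↭-trans (↭-reflexive (concat-++ ys zs)) (↭-trans (concat-↭ ys++zs↭Bs) concat-Bs↭S))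
                (Sublist.++⁺ʳ (concat zs) ⊆-refl)
... | T , T↭ys , T⊆S = T , T⊆S ,
  trans (σ-↭ T↭ys) (ZeroSum-concat (All.map proj₁ (proj₁ (++⁻ ys (All-resp-↭ (↭-sym ys++zs↭Bs) blocks))))) ,
  trans (↭-length T↭ys) (trans (length-concat ys) |ys|≡t)

theorem1 : (k t : ℕ) → 1 ≤ k → 1 ≤ t →
    (S'Finite k t → (d : ℕ) → 1 ≤ d → d ≤ D k → d ∣ t)
    × (((d : ℕ) → 1 ≤ d → d ≤ D k → d ∣ t) →
        Good k t (t + (2 * k ∸ 2) * (2 * k ∸ 3))
        × ((ℓ : ℕ) → 1 ≤ ℓ → Good k t ℓ → t + k * (k ∸ 1) ≤ ℓ))
theorem1 k t 1≤k 1≤t =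
  (λ (ℓ , _ , good) → Good⇒∣ 1≤k good) ,
  (λ ∣t → ∣t⇒Good 1≤k ∣t , λ ℓ _ good → Good⇒lower-bound 1≤k 1≤t good)
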